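{- Let $P$ be a finite poset, $I\in\mathcal{IC}(P)$, and let $x$ be a maximal element of $P$ or a minimal element of $P$. If $x\in I$, then $x\notin\mathrm{Row}(I)$.
   Context: A subset $I\subseteq P$ is interval-closed if whenever $x,y\in I$ and $x\le z\le y$, then $z\in I$; $\mathcal{IC}(P)$ is the set of interval-closed subsets. For $x\in P$, the toggle $t_x$ sends $I$ to $I\triangle\{x\}$ if this set is interval-closed, and to $I$ otherwise. Rowmotion is $\mathrm{Row}=t_{x_1}\circ\cdots\circ t_{x_N}$ for a linear extension $(x_1,\dots,x_N)$ of $P$ (so $t_{x_N}$ is applied first; independent of the choice). -}

module Defs where

open import Level using (Level; suc; _⊔_)
open import Data.Nat as ℕ using (ℕ)
open import Data.Bool using (Bool; true; false; not; if_then_else_)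
open import Data.Bool.Properties using () renaming (_≟_ to _≟ᵇ_)
open import Data.Fin using (Fin; toℕ)
open import Data.Fin.Properties using (all?)
open import Data.Vec using (Vec; lookup; updateAt)
open import Data.List using (List; length; foldr)
import Data.List as L
open import Data.List.Membership.Propositional using (_∈_)
open import Data.List.Relation.Unary.Unique.Propositional using (Unique)
open import Relation.Binary.PropositionalEquality using (_≡_)
open import Relation.Binary.Structures using (IsDecPartialOrder)
open import Relation.Nullary using (Dec; yes; no; ¬_)
open import Relation.Nullary.Decidable using (_→-dec_)

record FinPoset (n : ℕ) (ℓ : Level) : Set (suc ℓ) where
  field
    _≤_ : Fin n → Fin n → Set ℓ
    isDecPartialOrder : IsDecPartialOrder _≡_ _≤_
  open IsDecPartialOrder isDecPartialOrder public
    using () renaming (_≤?_ to _≤?_)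

Sub : ℕ → Set
Sub n = Vec Bool n

_∈S_ : ∀ {n} → Fin n → Sub n → Set
x ∈S I = lookup I x ≡ true

_∈S?_ : ∀ {n} (x : Fin n) (I : Sub n) → Dec (x ∈S I)
x ∈S? I = lookup I x ≟ᵇ true

module _ {n : ℕ} {ℓ : Level} (P : FinPoset n ℓ) where
  open FinPoset P

  IntervalClosed : Sub n → Set ℓ
  IntervalClosed I = ∀ x y z → x ∈S I → y ∈S I → x ≤ z → z ≤ y → z ∈S I

  intervalClosed? : (I : Sub n) → Dec (IntervalClosed I)
  intervalClosed? I =
    all? λ x → all? λ y → all? λ z →
      (x ∈S? I) →-dec ((y ∈S? I) →-dec ((x ≤? z) →-dec ((z ≤? y) →-dec (z ∈S? I))))

  flipAt : Fin n → Sub n → Sub n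
  flipAt x I = updateAt I x not

  toggle : Fin n → Sub n → Sub n
  toggle x I with intervalClosed? (flipAt x I)
  ... | yes _ = flipAt x I
  ... | no  _ = I

  record LinearExtension : Set ℓ where
    field
      elems    : List (Fin n)
      unique   : Unique elems
      complete : ∀ x → x ∈ elems
      monotone : ∀ (i j : Fin (length elems)) →
                 L.lookup elems i ≤ L.lookup elems j → toℕ i ℕ.≤ toℕ j

  -- Row = t_{x_1} ∘ ⋯ ∘ t_{x_N}  (t_{x_N} applied first)
  rowmotion : LinearExtension → Sub n → Sub n
  rowmotion e I = foldr toggle I (LinearExtension.elems e)

  Maximal : Fin n → Set ℓ
  Maximal x = ∀ y → x ≤ y → y ≡ x

  Minimal : Fin n → Set ℓ
  Minimal x = ∀ y → y ≤ x → y ≡ x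

-- Toggles only change their own element, and in a linear extension x occurs
-- exactly once.  So when t_x is applied, x still lies in the current set J,
-- which is interval-closed since toggles preserve interval-closedness.  An
-- extremal element can be removed from an interval-closed set without
-- breaking interval-closedness (it is never strictly between two members),
-- so t_x removes x, and the remaining toggles leave it out.
module Submission where

open import Defs
open import Level using (Level)
open import Data.Nat using (ℕ)
open import Data.Fin using (Fin; _≟_)
open import Data.Sum using (_⊎_; inj₁; inj₂)
open import Data.Bool using (false; not)
open import Data.Bool.Properties using (not-¬)
open import Data.Vec using (lookup)
open import Data.Vec.Properties using (lookup∘updateAt; lookup∘updateAt′)
open import Data.List using ([]; _∷_; foldr)
open import Data.List.Relation.Unary.Any using (here; there)
import Data.List.Relation.Unary.All as All
open import Data.List.Relation.Unary.All.Properties using (All¬⇒¬Any)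
open import Data.List.Relation.Unary.AllPairs using (_∷_)
open import Data.List.Membership.Propositional using (_∈_; _∉_)
open import Data.List.Relation.Unary.Unique.Propositional using (Unique)
open import Relation.Nullary using (¬_; yes; no; contradiction)
open import Relation.Binary.PropositionalEquality
  using (_≡_; _≢_; refl; sym; trans; cong; subst)

module _ {n : ℕ} {ℓ : Level} (P : FinPoset n ℓ) where

  toggle-preserves-IntervalClosed :
    ∀ y J → IntervalClosed P J → IntervalClosed P (toggle P y J)
  toggle-preserves-IntervalClosed y J J-ic with intervalClosed? P (flipAt P y J)
  ... | yes flip-ic = flip-ic
  ... | no  _       = J-ic

  foldr-toggle-preserves-IntervalClosed :
    ∀ ys J → IntervalClosed P J → IntervalClosed P (foldr (toggle P) J ys)
  foldr-toggle-preserves-IntervalClosed []       J J-ic = J-ic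
  foldr-toggle-preserves-IntervalClosed (y ∷ ys) J J-ic =
    toggle-preserves-IntervalClosed y _
      (foldr-toggle-preserves-IntervalClosed ys J J-ic)

  lookup-flipAt-≢ : ∀ {x y} J → x ≢ y → lookup (flipAt P y J) x ≡ lookup J x
  lookup-flipAt-≢ {x} {y} J x≢y = lookup∘updateAt′ x y x≢y J

  lookup-toggle-≢ : ∀ {x y} J → x ≢ y → lookup (toggle P y J) x ≡ lookup J x
  lookup-toggle-≢ {y = y} J x≢y with intervalClosed? P (flipAt P y J)
  ... | yes _ = lookup-flipAt-≢ J x≢y
  ... | no  _ = refl

  lookup-foldr-toggle-∉ :
    ∀ {x} ys J → x ∉ ys → lookup (foldr (toggle P) J ys) x ≡ lookup J x
  lookup-foldr-toggle-∉ []       J x∉ys = refl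
  lookup-foldr-toggle-∉ (y ∷ ys) J x∉ys =
    trans (lookup-toggle-≢ _ (λ x≡y → x∉ys (here x≡y)))
          (lookup-foldr-toggle-∉ ys J (λ x∈ys → x∉ys (there x∈ys)))

  lookup-flipAt-member : ∀ {x} J → x ∈S J → lookup (flipAt P x J) x ≡ false
  lookup-flipAt-member {x} J x∈J = trans (lookup∘updateAt x J) (cong not x∈J)

  flipAt-member-∉ : ∀ {x} J → x ∈S J → ¬ (x ∈S flipAt P x J)
  flipAt-member-∉ J x∈J x∈flip =
    not-¬ refl (trans (sym x∈flip) (lookup-flipAt-member J x∈J))

  flipAt-member-⊆ : ∀ {x z} J → x ∈S J → z ∈S flipAt P x J → z ∈S J
  flipAt-member-⊆ {x} {z} J x∈J z∈flip with z ≟ x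
  ... | yes refl = x∈J
  ... | no  z≢x  = trans (sym (lookup-flipAt-≢ J z≢x)) z∈flip

  removing-extremal-preserves-IntervalClosed :
    ∀ {x} J → Maximal P x ⊎ Minimal P x → IntervalClosed P J → x ∈S J →
    IntervalClosed P (flipAt P x J)
  removing-extremal-preserves-IntervalClosed {x} J extremal J-ic x∈J
    a b z a∈ b∈ a≤z z≤b with z ≟ x
  ... | no z≢x = trans (lookup-flipAt-≢ J z≢x)
    (J-ic a b z (flipAt-member-⊆ J x∈J a∈) (flipAt-member-⊆ J x∈J b∈) a≤z z≤b)
  ... | yes refl with extremal
  ...   | inj₁ maximal =
    contradiction (subst (_∈S flipAt P x J) (maximal b z≤b) b∈) (flipAt-member-∉ J x∈J)
  ...   | inj₂ minimal =
    contradiction (subst (_∈S flipAt P x J) (minimal a a≤z) a∈) (flipAt-member-∉ J x∈J)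

  toggle-removes-extremal :
    ∀ {x} J → Maximal P x ⊎ Minimal P x → IntervalClosed P J → x ∈S J →
    lookup (toggle P x J) x ≡ false
  toggle-removes-extremal {x} J extremal J-ic x∈J
    with intervalClosed? P (flipAt P x J)
  ... | no ¬flip-ic = contradiction
    (removing-extremal-preserves-IntervalClosed J extremal J-ic x∈J) ¬flip-ic
  ... | yes _ = lookup-flipAt-member J x∈J

  foldr-toggle-removes-extremal :
    ∀ {x} ys I → Unique ys → x ∈ ys → IntervalClosed P I →
    Maximal P x ⊎ Minimal P x → x ∈S I →
    lookup (foldr (toggle P) I ys) x ≡ false
  foldr-toggle-removes-extremal (y ∷ ys) I (y∉ys ∷ _) (here refl) I-ic extremal x∈I =
    toggle-removes-extremal _ extremal
      (foldr-toggle-preserves-IntervalClosed ys I I-ic)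
      (trans (lookup-foldr-toggle-∉ ys I (All¬⇒¬Any y∉ys)) x∈I)
  foldr-toggle-removes-extremal (y ∷ ys) I (y∉ys ∷ ys-unique) (there x∈ys) I-ic extremal x∈I =
    trans (lookup-toggle-≢ _ (λ x≡y → All.lookup y∉ys x∈ys (sym x≡y)))
          (foldr-toggle-removes-extremal ys I ys-unique x∈ys I-ic extremal x∈I)

lemma2p17 : ∀ {n : ℕ} {ℓ : Level} (P : FinPoset n ℓ) (e : LinearExtension P)
    (I : Sub n) → IntervalClosed P I → (x : Fin n) → Maximal P x ⊎ Minimal P x →
    x ∈S I → ¬ (x ∈S rowmotion P e I)
lemma2p17 P e I I-ic x extremal x∈I x∈Row =
  not-¬ refl (trans (sym x∈Row) x∉Row)
  where
    open LinearExtension e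
    x∉Row : lookup (rowmotion P e I) x ≡ false
    x∉Row = foldr-toggle-removes-extremal P elems I unique (complete x) I-ic extremal x∈I
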